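{- Let $\mathrm{li}\in P^{(1)}$ be such that for all indices $m$ of convergent sequences in $\textsc{Seq}$, $\mathrm{li}(m)$ is defined, $\mathrm{li}(m)\in\mathrm{dom}(x)$, $x_{\mathrm{li}(m)}\in\mathrm{Lim}_a x_{\varphi_m(a)}$, and $x_{\varphi_m(a)}\le_\tau x_{\mathrm{li}(m)}$ for all $a\in\omega$. Then $x$ has a limit algorithm.
   Context: Notation: $P^{(n)}$ ($R^{(n)}$) are the $n$-ary partial (total) computable functions; $\varphi$ a Gödel numbering of $P^{(1)}$. A numbering of a set $S$ is a partial map from $\omega$ onto $S$. Setting: $\mathcal T=(T,\tau)$ is a countable topological $T_0$ space with countable basis $\mathcal B$, $B$ ($n\mapsto B_n$) a total numbering of $\mathcal B$, $x$ a numbering of $T$, and $\prec_B$ a transitive relation on $\omega$ with $m\prec_B n\Rightarrow B_m\subseteq B_n$ such that whenever $z\in B_m\cap B_n$ there is $a$ with $z\in B_a$, $a\prec_B m$, $a\prec_B n$. A sequence $(y_a)_a$ in $T$ is computable if $y_a=x_{g(a)}$ for some $g\in R^{(1)}$ with range in $\mathrm{dom}(x)$; any Gödel number of $g$ is an index. Specialization order: $y\le_\tau z$ iff every $B_n$ containing $y$ contains $z$. $\mathrm{hl}(B_n)=\bigcap\{B_a:n\prec_B a\}$. A normed computable enumeration of basic open sets is $(B_{f(a)})_a$ with $f\in R^{(1)}$, $f(a+1)\prec_B f(a)$ (index: Gödel number of $f$); it converges to $y$ if $\{B_{f(a)}\}$ is a strong base of $\mathcal N(y)$ (a nonempty subfamily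 $\mathcal F$ of $\mathcal N(y)$ such that for $B_m,B_n\in\mathcal F$ some $B_a\in\mathcal F$ has $a\prec_B m,n$, and for each $B_m\in\mathcal N(y)$ some $B_a\in\mathcal F$ has $a\prec_B m$). $\mathrm{Lim}_a y_a$ is the set of topological limit points; convergent means nonempty. The space comes with a fixed collection $\textsc{Seq}$ of computable sequences such that: (1) every computable $\le_\tau$-monotonically increasing sequence is in $\textsc{Seq}$; (2) there is $p\in R^{(1)}$ such that for each index $m$ of a normed computable enumeration converging to $y$, $p(m)$ is an index of a sequence in $\textsc{Seq}$ with (a) $x_{\varphi_{p(m)}(a)}\in\mathrm{hl}(B_{\varphi_m(a)})$ for all $a$, (b) if $\mathcal T$ is not $T_1$, then for every basic open $B_n\notin\mathcal N(y)$ only finitely many $a$ have $x_{\varphi_{p(m)}(a)}\in B_n$; (3) if $(y_a)_a\in\textsc{Seq}$ then for every $\bar a$ the sequence equal to $y_a$ for $a<\bar a$ and $y_{\bar a}$ for $a\ge\bar a$ is in $\textsc{Seq}$. $x$ has a limit algorithm if there is $\mathrm{li}\in P^{(1)}$ such that for all indices $m,m'$ of convergent sequences in $\textsc{Seq}$: (i) $\mathrm{li}(m)$ is defined and in $\mathrm{dom}(x)$; (ii) $x_{\mathrm{li}(m)}\in\mathrm{Lim}_a x_{\varphi_m(a)}$; (iii) if $x_{\varphi_m(a)}=x_{\varphi_m(\bar a)}$ for all $a\ge\bar a$, then $x_{\mathrm{li}(m)}=x_{\varphi_m(\bar a)}$; (iv) if $\mathrm{Lim}_a x_{\varphi_m(a)}=\mathrm{Lim}_a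 x_{\varphi_{m'}(a)}$ then $x_{\mathrm{li}(m)}=x_{\mathrm{li}(m')}$. -}

module Defs where

open import Level using (0ℓ)
open import Data.Nat using (ℕ; suc; _≥_; _<ᵇ_)
open import Data.Bool using (if_then_else_)
open import Data.Product using (Σ; ∃; _×_; _,_)
open import Relation.Binary.PropositionalEquality using (_≡_)
open import Relation.Nullary using (¬_)
open import Function.Bundles using (_⇔_)

-- Partial functions ℕ ⇀ ℕ are represented by their graphs.
-- A Gödel numbering φ of P^(1): φ m a b  means  φ_m(a) is defined and = b.
-- P^(1) is, by definition, the range of φ, so "li ∈ P^(1)" is rendered as
-- "li = φ_e for some e" (the statement quantifies over the index e).

record Numbering : Set₁ where
  field
    φ     : ℕ → ℕ → ℕ → Set
    φ-fun : ∀ {m a b b'} → φ m a b → φ m a b' → b ≡ b'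

module _ (G : Numbering) where
  open Numbering G

  IndexR1 : ℕ → (ℕ → ℕ) → Set
  IndexR1 e f = ∀ a → φ e a (f a)

  record Space : Set₁ where
    field
      T     : Set
      B     : ℕ → T → Set
      -- numbering x of T (partial, surjective), given by its graph
      x     : ℕ → T → Set
      x-fun : ∀ {i t t'} → x i t → x i t' → t ≡ t'
      x-sur : ∀ t → ∃ λ i → x i t
      _≺_   : ℕ → ℕ → Set
      ≺-trans : ∀ {k m n} → k ≺ m → m ≺ n → k ≺ n
      ≺-⊆   : ∀ {m n} → m ≺ n → ∀ z → B m z → B n z
      ≺-∩   : ∀ {m n z} → B m z → B n z →
                ∃ λ a → B a z × a ≺ m × a ≺ n
      -- B is a basis (covering; intersection property given by ≺-∩)
      B-cover : ∀ z → ∃ λ n → B n z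
      T0    : ∀ y z → (∀ n → B n y ⇔ B n z) → y ≡ z

    Open : (T → Set) → Set
    Open U = ∀ z → U z → ∃ λ n → B n z × (∀ w → B n w → U w)

    _≤τ_ : T → T → Set
    y ≤τ z = ∀ n → B n y → B n z

    hl : ℕ → T → Set
    hl n z = ∀ a → n ≺ a → B a z

    IsT1 : Set
    IsT1 = ∀ y z → ¬ (y ≡ z) → ∃ λ n → B n y × ¬ B n z

    Lim : (ℕ → T) → T → Set₁
    Lim y z = (U : T → Set) → Open U → U z →
              ∃ λ N → ∀ a → a ≥ N → U (y a)

    IndexSeq : ℕ → (ℕ → T) → Set
    IndexSeq m y = ∀ a → ∃ λ k → φ m a k × x k (y a)

    Computable : (ℕ → T) → Set
    Computable y = ∃ λ m → IndexSeq m y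

    -- strong base of N(y), given as a family of indices F
    StrongBase : T → (ℕ → Set) → Set
    StrongBase y F =
      (∃ λ n → F n) ×
      (∀ n → F n → B n y) ×
      (∀ m n → F m → F n → ∃ λ a → F a × a ≺ m × a ≺ n) ×
      (∀ m → B m y → ∃ λ a → F a × a ≺ m)

    NormedConv : ℕ → (ℕ → ℕ) → T → Set
    NormedConv m f y =
      IndexR1 m f × (∀ a → f (suc a) ≺ f a) ×
      StrongBase y (λ n → ∃ λ a → n ≡ f a)

  record SeqSpace : Set₂ where
    field
      space : Space
    open Space space public
    field
      Seq     : (ℕ → T) → Set
      Seq-comp : ∀ y → Seq y → Computable y
      Seq-mono : ∀ y → Computable y → (∀ a → y a ≤τ y (suc a)) → Seq y
      Seq-p    : Σ (ℕ → ℕ) λ p → (∃ λ e → IndexR1 e p) ×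
        (∀ m y (f : ℕ → ℕ) → NormedConv m f y →
          Σ (ℕ → T) λ y' → Seq y' × IndexSeq (p m) y' ×
            (∀ a → hl (f a) (y' a)) ×
            (¬ IsT1 → ∀ n → ¬ B n y →
               ∃ λ N → ∀ a → a ≥ N → ¬ B n (y' a)))
      Seq-cut  : ∀ y → Seq y → ∀ ā →
        Seq (λ a → if a <ᵇ ā then y a else y ā)

  module _ (S : SeqSpace) where
    open SeqSpace S

    ConvIdx : ℕ → (ℕ → T) → Set₁
    ConvIdx m y = Seq y × IndexSeq m y × Σ T (Lim y)

    IsLimitAlgorithm : ℕ → Set₁
    IsLimitAlgorithm e =
      (∀ m y → ConvIdx m y →
        Σ ℕ λ k → φ e m k × Σ T λ t → x k t ×
          Lim y t ×
          (∀ ā → (∀ a → a ≥ ā → y a ≡ y ā) → t ≡ y ā)) ×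
      (∀ m m' y y' k k' t t' → ConvIdx m y → ConvIdx m' y' →
        φ e m k → φ e m' k' → x k t → x k' t' →
        (∀ z → (Lim y z → Lim y' z) × (Lim y' z → Lim y z)) → t ≡ t')

    HasLimitAlgorithm : Set₁
    HasLimitAlgorithm = Σ ℕ IsLimitAlgorithm

    WeakLimitAlgorithm : ℕ → Set₁
    WeakLimitAlgorithm e =
      ∀ m y → ConvIdx m y →
        Σ ℕ λ k → φ e m k × Σ T λ t → x k t ×
          Lim y t × (∀ a → y a ≤τ t)

module Submission where

-- The hypothesis gives, for every index m of a convergent sequence y in Seq,
-- a value t = x_{li(m)} that is a limit of y and an upper bound of all y a in
-- the specialization order ≤τ.  Two facts about an arbitrary T0 space do the
-- work:
--   * a limit of y lies ≤τ-below every eventual ≤τ-upper bound of y, because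
--     each basic neighbourhood of the limit eventually contains y;
--   * ≤τ is antisymmetric, which is exactly the T0 axiom.
-- Hence t is the ≤τ-greatest limit of y.  Property (iii) follows since an
-- eventually constant y with value y ā has y ā as an upper bound and y ā ≤τ t;
-- property (iv) follows since two sequences with the same limits have the same
-- greatest limit.  The algorithm li = φ_e itself is unchanged.

open import Defs
open import Data.Nat using (ℕ; _≥_; _⊔_)
open import Data.Nat.Properties using (m≤m⊔n; m≤n⊔m)
open import Data.Product using (Σ; _×_; _,_; proj₁; proj₂)
open import Function.Bundles using (mk⇔)
open import Relation.Binary.PropositionalEquality using (_≡_; subst)

module SpecializationFacts (G : Numbering) (X : Space G) where
  open Space X

  basic-open : ∀ n → Open (B n)
  basic-open n z bz = n , bz , λ w bw → bw

  ≤τ-antisym : ∀ {y z} → y ≤τ z → z ≤τ y → y ≡ z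
  ≤τ-antisym y≤z z≤y = T0 _ _ λ n → mk⇔ (y≤z n) (z≤y n)

  -- A limit lies below every eventual upper bound of the sequence: any basic
  -- neighbourhood of the limit contains some late term, hence the bound.
  limit-≤τ-eventual-bound : ∀ (y : ℕ → T) {t s} N → Lim y t →
    (∀ a → a ≥ N → y a ≤τ s) → t ≤τ s
  limit-≤τ-eventual-bound y N lim bound n bt with lim (B n) (basic-open n) bt
  ... | M , late = bound (M ⊔ N) (m≤n⊔m M N) n (late (M ⊔ N) (m≤m⊔n M N))

  limit-≤τ-bound : ∀ (y : ℕ → T) {t s} → Lim y t → (∀ a → y a ≤τ s) → t ≤τ s
  limit-≤τ-bound y lim bound = limit-≤τ-eventual-bound y 0 lim (λ a _ → bound a)

  -- A limit that bounds the sequence is its ≤τ-greatest limit; in particular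
  -- it is determined by the set of limits.
  greatest-limit-unique : ∀ (y y' : ℕ → T) {t t'} →
    Lim y t → (∀ a → y a ≤τ t) → Lim y' t' → (∀ a → y' a ≤τ t') →
    (∀ z → (Lim y z → Lim y' z) × (Lim y' z → Lim y z)) → t ≡ t'
  greatest-limit-unique y y' lim bound lim' bound' sameLim =
    ≤τ-antisym (limit-≤τ-bound y' (proj₁ (sameLim _) lim) bound')
               (limit-≤τ-bound y (proj₂ (sameLim _) lim') bound)

  greatest-limit-of-eventually-constant : ∀ (y : ℕ → T) {t} ā →
    Lim y t → (∀ a → y a ≤τ t) → (∀ a → a ≥ ā → y a ≡ y ā) → t ≡ y ā
  greatest-limit-of-eventually-constant y ā lim bound const =
    ≤τ-antisym (limit-≤τ-eventual-bound y ā lim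
                  (λ a a≥ā n → subst (B n) (const a a≥ā)))
               (bound ā)

module WeakToFull (G : Numbering) (S : SeqSpace G) (e : ℕ)
                  (W : WeakLimitAlgorithm G S e) where
  open Numbering G
  open SeqSpace S
  open SpecializationFacts G space

  -- Whatever code k = φ_e(m) and point t = x_k are chosen, t is the weak
  -- algorithm's output, since φ and x are single-valued.
  weak-output : ∀ {m y k t} → ConvIdx G S m y → φ e m k → x k t →
    Lim y t × (∀ a → y a ≤τ t)
  weak-output {m} {y} {k} {t} c φk xk with W m y c
  ... | k₀ , φk₀ , t₀ , xk₀ , lim , bound =
    subst (λ s → Lim y s × (∀ a → y a ≤τ s)) t₀≡t (lim , bound)
    where
    t₀≡t : t₀ ≡ t
    t₀≡t = x-fun (subst (λ j → x j t₀) (φ-fun φk₀ φk) xk₀) xk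

  defined-limit-stabilising : ∀ m y → ConvIdx G S m y →
    Σ ℕ λ k → φ e m k × Σ T λ t → x k t × Lim y t ×
      (∀ ā → (∀ a → a ≥ ā → y a ≡ y ā) → t ≡ y ā)
  defined-limit-stabilising m y c with W m y c
  ... | k , φk , t , xk , lim , bound =
    k , φk , t , xk , lim ,
    λ ā const → greatest-limit-of-eventually-constant y ā lim bound const

  extensional : ∀ m m' y y' k k' t t' → ConvIdx G S m y → ConvIdx G S m' y' →
    φ e m k → φ e m' k' → x k t → x k' t' →
    (∀ z → (Lim y z → Lim y' z) × (Lim y' z → Lim y z)) → t ≡ t'
  extensional m m' y y' k k' t t' c c' φk φk' xk xk' sameLim
    with weak-output c φk xk | weak-output c' φk' xk'
  ... | lim , bound | lim' , bound' =
    greatest-limit-unique y y' lim bound lim' bound' sameLim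

lemma5p9 : (G : Numbering) (S : SeqSpace G) (e : ℕ) →
    WeakLimitAlgorithm G S e → HasLimitAlgorithm G S
lemma5p9 G S e W = e , defined-limit-stabilising , extensional
  where open WeakToFull G S e W
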